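{- Let lists $C'(n,k)$ of strings over the alphabet $\{1\}\cup\{0_0,0_1,0_2,\ldots\}$ (a symbol $1$ and "marked zeros" $0_j$) be defined recursively for integers $n\ge 1$ and $0\le k\le n$ as follows: if $k=0$, $C'(n,0)$ is the one-element list consisting of the string $0_00_1\cdots0_{n-1}$; if $k=n$, $C'(n,n)$ is the one-element list consisting of $1^n$; if $0<k<n$, $C'(n,k)$ is the list consisting first of all strings of $C'(n-1,k)$, in order, each with the symbol $0_{n-k-1}$ appended at the right end, followed by all strings of $C'(n-1,k-1)$ taken in reverse order, in each of which every marked zero $0_j$ is replaced by $0_{(j-1)\bmod (n-k)}$, and each with the symbol $1$ appended at the right end. (Here $1^m$ denotes $m$ consecutive copies of $1$, and $C'(0,0)$ is understood as the list containing the empty string when needed in the recursion.) Then for all $n>0$ and all $k$ with $0\le k\le n$: 1. The first element of $C'(n,k)$ is $1^k0_00_1\cdots0_{n-k-1}$. 2. If $0<k<n$, the last element of $C'(n,k)$ is $1^{k-1}0_{n-k-1}0_00_1\cdots0_{n-k-2}1$. 3. Any two successive elements of $C'(n,k)$ differ in exactly two positions, where one of them has a marked zero and the other a $1$ (i.e. they differ by transposing a marked zero and a one).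
   Context: This is a "marked zeros" version of Ruskey's recursive Gray code $C(n,k)$ listing all bit strings with $k$ ones and $n-k$ zeros. Concatenation of strings is written by juxtaposition. -}

module Defs where

open import Data.Nat using (ℕ; zero; suc; _∸_; _<?_)
open import Data.Nat.DivMod using (_%_)
open import Data.Bool using (Bool; true; false)
open import Data.List using (List; []; _∷_; _++_; map; reverse; replicate; upTo; [_])
open import Data.Product using (∃; ∃-syntax; _×_)
open import Relation.Nullary using (yes; no; ¬_)
open import Relation.Binary.PropositionalEquality using (_≡_)

data Sym : Set where
  one  : Sym
  zer  : ℕ → Sym

Str : Set
Str = List Sym

ones : ℕ → Str
ones m = replicate m one

marks : ℕ → Str
marks m = map zer (upTo m)

-- replace 0_j by 0_{(j-1) mod (suc m')}; the modulus is  suc m'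
relabel : ℕ → Sym → Sym
relabel m' one           = one
relabel m' (zer zero)    = zer m'                 -- (0 - 1) mod (m'+1) = m'
relabel m' (zer (suc j)) = zer (j % suc m')

-- C'(n,k).  C'(0,0) = [ε]; C'(n,0) = [0_0…0_{n-1}]; C'(n,n) = [1^n];
-- for 0<k<n the recursive rule.  (Values for k > n are irrelevant junk.)
C' : ℕ → ℕ → List Str
C' zero    k       = [ [] ]
C' (suc n) zero    = [ marks (suc n) ]
C' (suc n) (suc k) with k <? n
... | yes _ = map (λ s → s ++ [ zer (n ∸ k ∸ 1) ]) (C' n (suc k))
           ++ map (λ s → map (relabel (n ∸ k ∸ 1)) s ++ [ one ]) (reverse (C' n k))
... | no  _ = [ ones (suc n) ]

isOne : Sym → Bool
isOne one     = true
isOne (zer _) = false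

-- s and t differ by transposing a (marked) zero and a one: the underlying
-- bit strings are  u a v b w  and  u b v a w  with a ≠ b, i.e. they differ in
-- exactly two positions, at each of which one string has a 1 and the other a
-- marked zero.
Transp : Str → Str → Set
Transp s t = ∃[ u ] ∃[ v ] ∃[ w ] ∃[ a ] ∃[ b ]
  (¬ a ≡ b) ×
  (map isOne s ≡ u ++ a ∷ v ++ b ∷ w) ×
  (map isOne t ≡ u ++ b ∷ v ++ a ∷ w)

-- C'(n+1,k+1) is the C'(n,k+1) block with a zero appended, followed by the reversed C'(n,k)
-- block with its zeros relabelled and a one appended. Appending a symbol and relabelling
-- do not change the underlying bit strings, and transposition is symmetric, so both blocks
-- are transposition-linked by induction. The last string of C'(n,j), 0 < j ≤ n, has bits
-- 1^(j-1) 0^(n-j) 1, so the seam joins 1^k 0^(n-k-1) 1 0 to 1^(k-1) 0^(n-k) 1 1, or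
-- 0^(n-1) 1 0 to 0^n 1 when k = 0: one transposition in both cases. The first string of
-- C'(n,k) comes from the first block, the last one from the first string 1^k 0_0…0_(n-k-1)
-- of C'(n-1,k-1), whose relabelled zeros are 0_(n-k-1) 0_0 … 0_(n-k-2).
module Submission where

open import Defs
open import Data.Bool using (Bool; true; false)
open import Data.List using (List; []; _∷_; _++_; _∷ʳ_; [_]; map; reverse; replicate; length; upTo; applyUpTo)
open import Data.List.Properties
  using (map-++; map-∘; map-cong; map-cong-local; map-replicate; map-applyUpTo;
         ++-assoc; ++-identityʳ; unfold-reverse; reverse-++; upTo-∷ʳ; length-upTo)
open import Data.List.Membership.Propositional.Properties using (∈-upTo⁻)
open import Data.List.Relation.Unary.All using (tabulate)
open import Data.List.Relation.Unary.Linked as Linked using (Linked; []; [-]; _∷_)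
open import Data.List.Relation.Unary.Linked.Properties using (map⁺)
open import Data.Nat using (ℕ; zero; suc; _<_; _≤_; _∸_; s≤s; _<?_)
open import Data.Nat.DivMod using (m≤n⇒m%n≡m)
open import Data.Nat.Properties using (n∸n≡0; ∸-+-assoc; +-comm; <⇒≤; <-irrefl; m≤n⇒m<n∨m≡n)
open import Data.Product using (_×_; ∃-syntax; _,_)
open import Data.Sum using (inj₁; inj₂)
open import Function using (flip; _∘_)
open import Relation.Binary.PropositionalEquality
  using (_≡_; _≢_; refl; sym; trans; cong; cong₂; subst; subst₂; module ≡-Reasoning)
open import Relation.Nullary using (yes; no; ¬_; contradiction)

open ≡-Reasoning

m∸n≡suc[m∸suc[n]] : ∀ {m n} → n < m → m ∸ n ≡ suc (m ∸ suc n)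
m∸n≡suc[m∸suc[n]] {suc m} {zero}  _          = refl
m∸n≡suc[m∸suc[n]] {suc m} {suc n} (s≤s n<m) = m∸n≡suc[m∸suc[n]] n<m

m∸n∸1≡m∸suc[n] : ∀ m n → m ∸ n ∸ 1 ≡ m ∸ suc n
m∸n∸1≡m∸suc[n] m n = trans (∸-+-assoc m n 1) (cong (m ∸_) (+-comm n 1))

∷-replicate-++ : ∀ {A : Set} n (x : A) ys → x ∷ replicate n x ++ ys ≡ replicate n x ++ x ∷ ys
∷-replicate-++ zero    x ys = refl
∷-replicate-++ (suc n) x ys = cong (x ∷_) (∷-replicate-++ n x ys)

map-const : ∀ {A B : Set} (y : B) (xs : List A) → map (λ _ → y) xs ≡ replicate (length xs) y
map-const y []       = refl
map-const y (x ∷ xs) = cong (y ∷_) (map-const y xs)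

HasHead : {A : Set} → List A → A → Set
HasHead xs x = ∃[ rest ] xs ≡ x ∷ rest

HasLast : {A : Set} → List A → A → Set
HasLast xs x = ∃[ init ] xs ≡ init ∷ʳ x

HasLast-map : ∀ {A B : Set} (f : A → B) {xs x} → HasLast xs x → HasLast (map f xs) (f x)
HasLast-map f (init , refl) = map f init , map-++ f init [ _ ]

HasHead-map : ∀ {A B : Set} (f : A → B) {xs x} → HasHead xs x → HasHead (map f xs) (f x)
HasHead-map f (rest , refl) = map f rest , refl

HasLast-reverse : ∀ {A : Set} {xs : List A} {x} → HasLast xs x → HasHead (reverse xs) x
HasLast-reverse (init , refl) = reverse init , reverse-++ init [ _ ]

module _ {A : Set} {R : A → A → Set} where

  ++⁺-∷ʳ : ∀ xs {x y ys} → Linked R (xs ∷ʳ x) → R x y → Linked R (y ∷ ys) →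
           Linked R ((xs ∷ʳ x) ++ y ∷ ys)
  ++⁺-∷ʳ []           [-]        Rxy Rys = Rxy ∷ Rys
  ++⁺-∷ʳ (_ ∷ [])     (r ∷ [-])  Rxy Rys = r ∷ Rxy ∷ Rys
  ++⁺-∷ʳ (_ ∷ z ∷ xs) (r ∷ Rxs)  Rxy Rys = r ∷ ++⁺-∷ʳ (z ∷ xs) Rxs Rxy Rys

  join : ∀ {xs ys x y} → HasLast xs x → HasHead ys y →
         Linked R xs → R x y → Linked R ys → Linked R (xs ++ ys)
  join (init , refl) (rest , refl) = ++⁺-∷ʳ init

reverse⁺ : ∀ {A : Set} {R : A → A → Set} {xs} → Linked R xs → Linked (flip R) (reverse xs)
reverse⁺ []                           = []
reverse⁺ [-]                          = [-]
reverse⁺ {xs = x ∷ y ∷ xs} (Rxy ∷ Rxs) =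
  subst (Linked _) (sym (unfold-reverse x (y ∷ xs)))
    (join (reverse xs , unfold-reverse y xs) ([] , refl) (reverse⁺ Rxs) Rxy [-])

trues falses : ℕ → List Bool
trues  k = replicate k true
falses k = replicate k false

bits : Str → List Bool
bits = map isOne

-- Transp s t unfolds to Transposed (bits s) (bits t).
Transposed : List Bool → List Bool → Set
Transposed X Y = ∃[ u ] ∃[ v ] ∃[ w ] ∃[ a ] ∃[ b ]
  (¬ a ≡ b) × (X ≡ u ++ a ∷ v ++ b ∷ w) × (Y ≡ u ++ b ∷ v ++ a ∷ w)

Transposed-sym : ∀ {X Y} → Transposed X Y → Transposed Y X
Transposed-sym (u , v , w , a , b , a≢b , X≡ , Y≡) = u , v , w , b , a , a≢b ∘ sym , Y≡ , X≡

Transposed-∷ʳ : ∀ {X Y} c → Transposed X Y → Transposed (X ∷ʳ c) (Y ∷ʳ c)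
Transposed-∷ʳ c (u , v , w , a , b , a≢b , refl , refl) =
  u , v , w ∷ʳ c , a , b , a≢b , shift a b , shift b a
  where
  shift : ∀ a b → (u ++ a ∷ v ++ b ∷ w) ∷ʳ c ≡ u ++ a ∷ v ++ b ∷ (w ∷ʳ c)
  shift a b = trans (++-assoc u _ [ c ]) (cong (λ z → u ++ a ∷ z) (++-assoc v (b ∷ w) [ c ]))

Transposed-swap : ∀ u v {a b} → a ≢ b → Transposed (u ++ a ∷ v ++ [ b ]) (u ++ b ∷ v ++ [ a ])
Transposed-swap u v a≢b = u , v , [] , _ , _ , a≢b , refl , refl

seam₀ : ∀ n → Transposed ((falses n ++ [ true ]) ∷ʳ false) (falses (suc n) ∷ʳ true)
seam₀ n = subst₂ Transposed
  (sym (++-assoc (falses n) [ true ] [ false ]))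
  (sym (∷-replicate-++ n false [ true ]))
  (Transposed-swap (falses n) [] λ ())

seam : ∀ k m → Transposed ((trues (suc k) ++ falses m ++ [ true ]) ∷ʳ false)
                          ((trues k ++ falses (suc m) ++ [ true ]) ∷ʳ true)
seam k m = subst₂ Transposed
  (sym (trans (++-assoc (trues (suc k)) _ [ false ]) (∷-replicate-++ k true _)))
  (sym (++-assoc (trues k) _ [ true ]))
  (Transposed-swap (trues k) (falses m ++ [ true ]) λ ())

Transp-snoc : ∀ {h : Str → Str} c → (∀ s → bits (h s) ≡ bits s ∷ʳ c) →
              ∀ {s t} → Transp s t → Transp (h s) (h t)
Transp-snoc c bits-h T = subst₂ Transposed (sym (bits-h _)) (sym (bits-h _)) (Transposed-∷ʳ c T)

append₀ : ℕ → Str → Str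
append₀ d s = s ∷ʳ zer d

relabel-append₁ : ℕ → Str → Str
relabel-append₁ d s = map (relabel d) s ∷ʳ one

isOne-relabel : ∀ d x → isOne (relabel d x) ≡ isOne x
isOne-relabel d one           = refl
isOne-relabel d (zer zero)    = refl
isOne-relabel d (zer (suc j)) = refl

bits-append₀ : ∀ d s → bits (append₀ d s) ≡ bits s ∷ʳ false
bits-append₀ d s = map-++ isOne s [ zer d ]

bits-relabel-append₁ : ∀ d s → bits (relabel-append₁ d s) ≡ bits s ∷ʳ true
bits-relabel-append₁ d s = begin
  bits (map (relabel d) s ∷ʳ one)  ≡⟨ map-++ isOne (map (relabel d) s) [ one ] ⟩
  bits (map (relabel d) s) ∷ʳ true ≡⟨ cong (_∷ʳ true) (sym (map-∘ s)) ⟩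
  map (isOne ∘ relabel d) s ∷ʳ true ≡⟨ cong (_∷ʳ true) (map-cong (isOne-relabel d) s) ⟩
  bits s ∷ʳ true                   ∎

marks-∷ʳ : ∀ d → marks d ∷ʳ zer d ≡ marks (suc d)
marks-∷ʳ d = trans (sym (map-++ zer (upTo d) [ d ])) (cong (map zer) (upTo-∷ʳ d))

relabel-marks : ∀ d → map (relabel d) (marks (suc d)) ≡ zer d ∷ marks d
relabel-marks d = cong (zer d ∷_) (begin
  map (relabel d) (map zer (applyUpTo suc d))
    ≡⟨ sym (map-∘ (applyUpTo suc d)) ⟩
  map (relabel d ∘ zer) (applyUpTo suc d)
    ≡⟨ cong (map (relabel d ∘ zer)) (sym (map-applyUpTo (λ i → i) suc d)) ⟩
  map (relabel d ∘ zer) (map suc (upTo d))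
    ≡⟨ sym (map-∘ (upTo d)) ⟩
  map (relabel d ∘ zer ∘ suc) (upTo d)
    ≡⟨ map-cong-local (tabulate λ i∈ → cong zer (m≤n⇒m%n≡m (<⇒≤ (∈-upTo⁻ i∈)))) ⟩
  marks d ∎)

bits-marks : ∀ m → bits (marks m) ≡ falses m
bits-marks m = begin
  map isOne (map zer (upTo m))     ≡⟨ sym (map-∘ (upTo m)) ⟩
  map (λ _ → false) (upTo m)       ≡⟨ map-const false (upTo m) ⟩
  falses (length (upTo m))         ≡⟨ cong falses (length-upTo m) ⟩
  falses m                         ∎

bits-ones-marks : ∀ k m → bits (ones k ++ marks m) ≡ trues k ++ falses m
bits-ones-marks k m =
  trans (map-++ isOne (ones k) (marks m)) (cong₂ _++_ (map-replicate isOne k one) (bits-marks m))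

C'-step : ∀ {n k} → k < n →
  C' (suc n) (suc k) ≡ map (append₀ (n ∸ k ∸ 1)) (C' n (suc k))
                    ++ map (relabel-append₁ (n ∸ k ∸ 1)) (reverse (C' n k))
C'-step {n} {k} k<n with k <? n
... | yes _   = refl
... | no  k≮n = contradiction k<n k≮n

C'-diagonal : ∀ n → C' (suc n) (suc n) ≡ [ ones (suc n) ]
C'-diagonal n with n <? n
... | yes n<n = contradiction n<n (<-irrefl refl)
... | no  _   = refl

append₀-ones-marks : ∀ {n k} → k < n →
  append₀ (n ∸ k ∸ 1) (ones (suc k) ++ marks (n ∸ suc k)) ≡ ones (suc k) ++ marks (n ∸ k)
append₀-ones-marks {n} {k} k<n = begin
  (ones (suc k) ++ marks (n ∸ suc k)) ∷ʳ zer (n ∸ k ∸ 1)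
    ≡⟨ cong (λ i → (ones (suc k) ++ marks (n ∸ suc k)) ∷ʳ zer i) (m∸n∸1≡m∸suc[n] n k) ⟩
  (ones (suc k) ++ marks (n ∸ suc k)) ∷ʳ zer (n ∸ suc k)
    ≡⟨ ++-assoc (ones (suc k)) (marks (n ∸ suc k)) _ ⟩
  ones (suc k) ++ marks (n ∸ suc k) ∷ʳ zer (n ∸ suc k)
    ≡⟨ cong (ones (suc k) ++_) (marks-∷ʳ (n ∸ suc k)) ⟩
  ones (suc k) ++ marks (suc (n ∸ suc k))
    ≡⟨ cong (λ m → ones (suc k) ++ marks m) (sym (m∸n≡suc[m∸suc[n]] k<n)) ⟩
  ones (suc k) ++ marks (n ∸ k) ∎

relabel-append₁-ones-marks : ∀ {n k} → k < n →
  relabel-append₁ (n ∸ k ∸ 1) (ones k ++ marks (n ∸ k))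
    ≡ ones k ++ zer (n ∸ k ∸ 1) ∷ marks (n ∸ k ∸ 1) ++ [ one ]
relabel-append₁-ones-marks {n} {k} k<n = begin
  map (relabel d) (ones k ++ marks (n ∸ k)) ∷ʳ one
    ≡⟨ cong (λ m → map (relabel d) (ones k ++ marks m) ∷ʳ one) n∸k≡suc[d] ⟩
  map (relabel d) (ones k ++ marks (suc d)) ∷ʳ one
    ≡⟨ cong (_∷ʳ one) (map-++ (relabel d) (ones k) (marks (suc d))) ⟩
  (map (relabel d) (ones k) ++ map (relabel d) (marks (suc d))) ∷ʳ one
    ≡⟨ cong₂ (λ xs ys → (xs ++ ys) ∷ʳ one) (map-replicate (relabel d) k one) (relabel-marks d) ⟩
  (ones k ++ zer d ∷ marks d) ∷ʳ one
    ≡⟨ ++-assoc (ones k) (zer d ∷ marks d) [ one ] ⟩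
  ones k ++ zer d ∷ marks d ++ [ one ] ∎
  where
  d = n ∸ k ∸ 1
  n∸k≡suc[d] : n ∸ k ≡ suc d
  n∸k≡suc[d] = trans (m∸n≡suc[m∸suc[n]] k<n) (cong suc (sym (m∸n∸1≡m∸suc[n] n k)))

C'-head : ∀ n k → k ≤ n → HasHead (C' n k) (ones k ++ marks (n ∸ k))
C'-head zero    zero    _         = [] , refl
C'-head (suc n) zero    _         = [] , refl
C'-head (suc n) (suc k) (s≤s k≤n) with m≤n⇒m<n∨m≡n k≤n
... | inj₂ refl = [] , (begin
  C' (suc k) (suc k)                  ≡⟨ C'-diagonal k ⟩
  [ ones (suc k) ]                    ≡⟨ cong [_] (sym (++-identityʳ (ones (suc k)))) ⟩
  [ ones (suc k) ++ marks 0 ]         ≡⟨ cong (λ m → [ ones (suc k) ++ marks m ]) (sym (n∸n≡0 k)) ⟩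
  [ ones (suc k) ++ marks (k ∸ k) ]   ∎)
... | inj₁ k<n with rest , C'≡ ← C'-head n (suc k) k<n =
  map (append₀ d) rest ++ second , (begin
  C' (suc n) (suc k)                                           ≡⟨ C'-step k<n ⟩
  map (append₀ d) (C' n (suc k)) ++ second                     ≡⟨ cong (λ xs → map (append₀ d) xs ++ second) C'≡ ⟩
  append₀ d (ones (suc k) ++ marks (n ∸ suc k)) ∷ map (append₀ d) rest ++ second
    ≡⟨ cong (_∷ map (append₀ d) rest ++ second) (append₀-ones-marks k<n) ⟩
  (ones (suc k) ++ marks (n ∸ k)) ∷ map (append₀ d) rest ++ second ∎)
  where
  d = n ∸ k ∸ 1
  second = map (relabel-append₁ d) (reverse (C' n k))

C'-last : ∀ {n k} → k < n →
  HasLast (C' (suc n) (suc k)) (relabel-append₁ (n ∸ k ∸ 1) (ones k ++ marks (n ∸ k)))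
C'-last {n} {k} k<n with rest , C'≡ ← C'-head n k (<⇒≤ k<n) =
  first ++ map g (reverse rest) , (begin
  C' (suc n) (suc k)                          ≡⟨ C'-step k<n ⟩
  first ++ map g (reverse (C' n k))           ≡⟨ cong (λ xs → first ++ map g (reverse xs)) C'≡ ⟩
  first ++ map g (reverse (x ∷ rest))         ≡⟨ cong (λ xs → first ++ map g xs) (unfold-reverse x rest) ⟩
  first ++ map g (reverse rest ∷ʳ x)          ≡⟨ cong (first ++_) (map-++ g (reverse rest) [ x ]) ⟩
  first ++ (map g (reverse rest) ∷ʳ g x)      ≡⟨ sym (++-assoc first (map g (reverse rest)) [ g x ]) ⟩
  (first ++ map g (reverse rest)) ∷ʳ g x      ∎)
  where
  x = ones k ++ marks (n ∸ k)
  g = relabel-append₁ (n ∸ k ∸ 1)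
  first = map (append₀ (n ∸ k ∸ 1)) (C' n (suc k))

-- This includes the diagonal C'(n,n) = [1^n].
C'-last-bits : ∀ {n k} → k < n →
  ∃[ l ] HasLast (C' n (suc k)) l × bits l ≡ trues k ++ falses (n ∸ suc k) ++ [ true ]
C'-last-bits {suc n} {k} (s≤s k≤n) with m≤n⇒m<n∨m≡n k≤n
... | inj₁ k<n = _ , C'-last k<n , (begin
  bits (relabel-append₁ (n ∸ k ∸ 1) (ones k ++ marks (n ∸ k)))
    ≡⟨ bits-relabel-append₁ (n ∸ k ∸ 1) (ones k ++ marks (n ∸ k)) ⟩
  bits (ones k ++ marks (n ∸ k)) ∷ʳ true
    ≡⟨ cong (_∷ʳ true) (bits-ones-marks k (n ∸ k)) ⟩
  (trues k ++ falses (n ∸ k)) ∷ʳ true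
    ≡⟨ ++-assoc (trues k) (falses (n ∸ k)) [ true ] ⟩
  trues k ++ falses (n ∸ k) ++ [ true ] ∎)
... | inj₂ refl = ones (suc k) , ([] , C'-diagonal k) , (begin
  true ∷ bits (ones k)                    ≡⟨ cong (true ∷_) (map-replicate isOne k one) ⟩
  true ∷ trues k                          ≡⟨ cong (true ∷_) (sym (++-identityʳ (trues k))) ⟩
  true ∷ trues k ++ []                    ≡⟨ ∷-replicate-++ k true [] ⟩
  trues k ++ falses 0 ++ [ true ]         ≡⟨ cong (λ m → trues k ++ falses m ++ [ true ]) (sym (n∸n≡0 k)) ⟩
  trues k ++ falses (k ∸ k) ++ [ true ]   ∎)

C'-seam : ∀ {n k} → k < n →
  ∃[ a ] ∃[ b ] HasLast (C' n (suc k)) a × HasLast (C' n k) b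
              × Transposed (bits a ∷ʳ false) (bits b ∷ʳ true)
C'-seam {suc n} {zero} 0<n with a , last-a , bits-a ← C'-last-bits 0<n =
  a , marks (suc n) , last-a , ([] , refl) ,
  subst₂ Transposed (cong (_∷ʳ false) (sym bits-a)) (cong (_∷ʳ true) (sym (bits-marks (suc n))))
    (seam₀ n)
C'-seam {n} {suc k} k<n
  with a , last-a , bits-a ← C'-last-bits k<n
     | b , last-b , bits-b ← C'-last-bits (<⇒≤ k<n) =
  a , b , last-a , last-b ,
  subst₂ Transposed (cong (_∷ʳ false) (sym bits-a)) (cong (_∷ʳ true) (sym bits-b′))
    (seam k (n ∸ suc (suc k)))
  where
  bits-b′ : bits b ≡ trues k ++ falses (suc (n ∸ suc (suc k))) ++ [ true ]
  bits-b′ = trans bits-b (cong (λ m → trues k ++ falses m ++ [ true ]) (m∸n≡suc[m∸suc[n]] k<n))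

C'-linked-step : ∀ {n k} → k < n → Linked Transp (C' n (suc k)) → Linked Transp (C' n k) →
                 Linked Transp (C' (suc n) (suc k))
C'-linked-step {n} {k} k<n linked-A linked-B
  with a , b , last-a , last-b , a~b ← C'-seam k<n =
  subst (Linked Transp) (sym (C'-step k<n))
    (join (HasLast-map (append₀ d) last-a) (HasHead-map (relabel-append₁ d) (HasLast-reverse last-b))
      (map⁺ (Linked.map (Transp-snoc false (bits-append₀ d)) linked-A))
      (subst₂ Transposed (sym (bits-append₀ d a)) (sym (bits-relabel-append₁ d b)) a~b)
      (map⁺ (Linked.map (Transp-snoc true (bits-relabel-append₁ d) ∘ Transposed-sym) (reverse⁺ linked-B))))
  where
  d = n ∸ k ∸ 1

C'-linked : ∀ n k → k ≤ n → Linked Transp (C' n k)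
C'-linked zero    _       _         = [-]
C'-linked (suc n) zero    _         = [-]
C'-linked (suc n) (suc k) (s≤s k≤n) with m≤n⇒m<n∨m≡n k≤n
... | inj₁ k<n  = C'-linked-step k<n (C'-linked n (suc k) k<n) (C'-linked n k k≤n)
... | inj₂ refl = subst (Linked Transp) (sym (C'-diagonal k)) [-]

mainTheorem1 : (n k : ℕ) → 0 < n → k ≤ n →
    (∃[ rest ] C' n k ≡ (ones k ++ marks (n ∸ k)) ∷ rest)
    × (0 < k → k < n →
        ∃[ init ] C' n k ≡ init ∷ʳ (ones (k ∸ 1) ++ zer (n ∸ k ∸ 1) ∷ marks (n ∸ k ∸ 1) ++ [ one ]))
    × Linked Transp (C' n k)
mainTheorem1 n k _ k≤n = C'-head n k k≤n , last-string k , C'-linked n k k≤n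
  where
  last-string : ∀ k → 0 < k → k < n →
    HasLast (C' n k) (ones (k ∸ 1) ++ zer (n ∸ k ∸ 1) ∷ marks (n ∸ k ∸ 1) ++ [ one ])
  last-string (suc k) _ (s≤s k<n′) with init , C'≡ ← C'-last k<n′ =
    init , trans C'≡ (cong (init ∷ʳ_) (relabel-append₁-ones-marks k<n′))
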